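{- For all integers $1\le k\le n$ and every $\pi\in\Pi(n)$, \[ |S^{M}_{\mathrm{out}}(\pi;k)| = |S^{M}_{\mathrm{in}}(\pi;k)| = (n-k+1)(2^{k-1}-1)+1. \]
   Context: $\Pi(n)$ denotes the set of permutations of $\{1,\dots,n\}$, each regarded as a sequence $\pi=(\pi_1,\dots,\pi_n)$. A mirror TDRL (MTDRL) operation on a sequence $(x_1,\dots,x_m)$ of distinct symbols is specified by $b\in\{0,1\}^m$. Its result is the concatenation of $(x_i:b_i=1)$, with indices in increasing order, followed by $(x_i:b_i=0)$, with indices in decreasing order. A bounded MTDRL operation of width $k$ on $\pi\in\Pi(n)$ proceeds as follows: choose $j$ with $1\le j\le n-k+1$, apply an MTDRL operation to the segment $(\pi_j,\dots,\pi_{j+k-1})$, and replace this segment by the result, leaving all other entries in place. $S^{M}_{\mathrm{out}}(\pi;k)$ is the set of all permutations obtainable from $\pi$ by one bounded MTDRL operation of width $k$. $S^{M}_{\mathrm{in}}(\pi;k)=\{\rho\in\Pi(n):\pi\in S^{M}_{\mathrm{out}}(\rho;k)\}$. -}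

module Defs where

open import Data.Nat using (ℕ; _+_; _≤_)
open import Data.Bool using (Bool; true; false)
open import Data.List using (List; []; _∷_; _++_; take; drop; reverse; length; map; upTo; zip)
open import Data.Vec using (Vec; toList)
open import Data.Product using (Σ; _×_; ∃; ∃-syntax)
open import Data.List.Membership.Propositional using (_∈_)
open import Data.List.Relation.Unary.Unique.Propositional using (Unique)
open import Data.List.Relation.Binary.Permutation.Propositional using (_↭_)
open import Function.Bundles using (_⇔_)
open import Relation.Binary.PropositionalEquality using (_≡_)

-- Π(n): sequences of length n that are rearrangements of (1,…,n).
IsPerm : ℕ → List ℕ → Set
IsPerm n π = π ↭ map Data.Nat.suc (upTo n)

ones : {A : Set} → List (A × Bool) → List A
ones [] = []
ones ((x Data.Product., true) ∷ xs) = x ∷ ones xs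
ones ((x Data.Product., false) ∷ xs) = ones xs

zeros : {A : Set} → List (A × Bool) → List A
zeros [] = []
zeros ((x Data.Product., true) ∷ xs) = zeros xs
zeros ((x Data.Product., false) ∷ xs) = x ∷ zeros xs

-- MTDRL operation specified by b on a sequence xs (|b| = |xs|):
-- (x_i : b_i = 1) increasing, then (x_i : b_i = 0) decreasing.
mtdrl : {A : Set} {m : ℕ} → Vec Bool m → List A → List A
mtdrl b xs = ones (zip xs (toList b)) ++ reverse (zeros (zip xs (toList b)))

-- Bounded MTDRL of width k at (0-based) position j: apply mtdrl b to
-- the segment π_{j+1},…,π_{j+k} and put the result back in place.
bmtdrl : (k j : ℕ) → Vec Bool k → List ℕ → List ℕ
bmtdrl k j b π = take j π ++ mtdrl b (take k (drop j π)) ++ drop (j + k) π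

-- ρ ∈ S^M_out(π;k)  (0-based j with j + k ≤ n, i.e. 1 ≤ j+1 ≤ n-k+1)
Sout : ℕ → List ℕ → List ℕ → Set
Sout k π ρ = ∃[ j ] (j + k ≤ length π × ∃[ b ] (ρ ≡ bmtdrl k j b π))

-- ρ ∈ S^M_in(π;k) = {ρ ∈ Π(n) : π ∈ S^M_out(ρ;k)}
Sin : ℕ → ℕ → List ℕ → List ℕ → Set
Sin n k π ρ = IsPerm n ρ × Sout k ρ π

HasCard : (List ℕ → Set) → ℕ → Set
HasCard P N = Σ (List (List ℕ)) λ L →
  Unique L × (∀ x → (x ∈ L) ⇔ P x) × length L ≡ N

module Submission where

open import Defs
open import Data.Nat using (ℕ; zero; suc; _+_; _*_; _∸_; _^_; _≤_; _<_; z≤n; s≤s)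
open import Data.Nat.Properties
  using (suc-injective; 0≢1+n; +-comm; +-suc; +-identityʳ; +-∸-assoc; m^n>0; ≤-antisym; +-cancelʳ-≤;
         m+n≤o⇒n≤o; m+n≤o⇒m≤o∸n; m≤o∸n⇒m+n≤o; m<1+n⇒m≤n; m≤n⇒m⊓n≡m)
open import Data.Bool using (Bool; true; false; _≟_)
open import Data.List
  using (List; []; _∷_; _++_; _∷ʳ_; [_]; take; drop; reverse; length; map; upTo; cartesianProduct;
         _∷ʳ′_; initLast; zip)
open import Data.List.Properties
  using (length-++; length-map; length-take; length-upTo; take++drop≡id; ++-assoc; ++-cancelˡ;
         ++-cancelʳ; unfold-reverse; ∷-injectiveˡ; ∷-injectiveʳ; ∷ʳ-injectiveˡ)
open import Data.Vec as Vec using (Vec; []; _∷_)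
import Data.Vec.Properties as Vecₚ
open import Data.List.Membership.Propositional using (_∈_; _∉_)
open import Data.List.Membership.Propositional.Properties
  using (∈-++⁺ˡ; ∈-++⁺ʳ; ∈-++⁻; ∈-map⁺; ∈-map⁻; ∈-upTo⁺; ∈-upTo⁻; ∈-cartesianProduct⁺; ∈-cartesianProduct⁻)
open import Data.List.Relation.Unary.Any using (here; there)
open import Data.List.Relation.Unary.All as All using (All; []; _∷_)
import Data.List.Relation.Unary.All.Properties as Allₚ
open import Data.List.Relation.Unary.AllPairs using ([]; _∷_)
open import Data.List.Relation.Unary.Unique.Propositional using (Unique)
import Data.List.Relation.Unary.Unique.Propositional.Properties as Uniqueₚ
open import Data.List.Relation.Binary.Permutation.Propositional
  using (_↭_; prep; ↭-refl; ↭-sym; ↭-trans; ↭-reflexive; ↭⇒↭ₛ)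
open import Data.List.Relation.Binary.Permutation.Propositional.Properties
  using (∷↭∷ʳ; zoom; ↭-length; All-resp-↭)
import Data.List.Relation.Binary.Permutation.Setoid.Properties as Permₛ
open import Data.Product using (_×_; _,_; proj₁; proj₂; ∃₂; ∃-syntax)
open import Data.Sum using (_⊎_; inj₁; inj₂)
open import Data.Empty using (⊥-elim)
open import Function using (_∘_)
open import Function.Bundles using (_⇔_; mk⇔; Equivalence)
open import Relation.Nullary using (yes; no; ¬_; contradiction)
open import Relation.Binary.PropositionalEquality
  using (_≡_; _≢_; refl; sym; trans; cong; cong₂; subst; setoid; module ≡-Reasoning)

-- Write k = 1 + m.  An MTDRL code b ∈ {0,1}^k acting on a window of
-- k entries ignores its last bit: the last entry always lands at the junction of
-- the increasing and the decreasing part.  What remains is a "shuffle" by a code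
-- bs ∈ {0,1}^m (true: the entry stays in front, false: it is moved behind all
-- later ones), which is a bijection of lists with an explicit inverse.  A move
-- (j , bs) applies the shuffle to the window at position j.  If σ has no repeated
-- entries and bs is not the all-true identity code, the move changes the last
-- entry of the window; hence j + k is exactly the first position from which the
-- result agrees with σ.  This recovers j from the result, the window then recovers
-- bs, and the move differs from σ.  So S_out(σ;k) is σ together with the injective
-- image of the (n - k + 1)(2^m - 1) non-identity moves; S_in(π;k) is π together
-- with the injective image of the inverse moves.  A general counting lemma
-- (a base point plus an injective image avoiding it) turns both descriptions into
-- the cardinality (n - k + 1)(2^(k-1) - 1) + 1.

allTrue : ∀ {m} → Vec Bool m
allTrue {m} = Vec.replicate m true

module _ {A : Set} where

  take-length-++ : ∀ (xs : List A) {ys} → take (length xs) (xs ++ ys) ≡ xs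
  take-length-++ []       = refl
  take-length-++ (x ∷ xs) = cong (x ∷_) (take-length-++ xs)

  drop-length-++ : ∀ (xs : List A) {ys} → drop (length xs) (xs ++ ys) ≡ ys
  drop-length-++ []       = refl
  drop-length-++ (x ∷ xs) = drop-length-++ xs

  length-∷ʳ : ∀ (xs : List A) {x} → length (xs ∷ʳ x) ≡ suc (length xs)
  length-∷ʳ xs = trans (length-++ xs) (+-comm (length xs) 1)

  splitLast : A → List A → List A × A
  splitLast x []       = [] , x
  splitLast x (y ∷ ys) = let (zs , z) = splitLast y ys in x ∷ zs , z

  splitLast-∷ʳ : ∀ x xs y → splitLast x (xs ∷ʳ y) ≡ (x ∷ xs , y)
  splitLast-∷ʳ x []        y = refl
  splitLast-∷ʳ x (x′ ∷ xs) y rewrite splitLast-∷ʳ x′ xs y = refl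

  splitLast-sound : ∀ x xs → proj₁ (splitLast x xs) ∷ʳ proj₂ (splitLast x xs) ≡ x ∷ xs
  splitLast-sound x []       = refl
  splitLast-sound x (y ∷ ys) = cong (x ∷_) (splitLast-sound y ys)

  shuffle : ∀ {m} → Vec Bool m → List A → List A
  shuffle []           xs       = xs
  shuffle (b ∷ bs)     []       = []
  shuffle (true ∷ bs)  (x ∷ xs) = x ∷ shuffle bs xs
  shuffle (false ∷ bs) (x ∷ xs) = shuffle bs xs ∷ʳ x

  unshuffle : ∀ {m} → Vec Bool m → List A → List A
  unshuffle []           ys       = ys
  unshuffle (b ∷ bs)     []       = []
  unshuffle (true ∷ bs)  (y ∷ ys) = y ∷ unshuffle bs ys
  unshuffle (false ∷ bs) (y ∷ ys) = proj₂ (splitLast y ys) ∷ unshuffle bs (proj₁ (splitLast y ys))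

  shuffle-allTrue : ∀ {m} (xs : List A) → shuffle (allTrue {m}) xs ≡ xs
  shuffle-allTrue {zero}  xs       = refl
  shuffle-allTrue {suc m} []       = refl
  shuffle-allTrue {suc m} (x ∷ xs) = cong (x ∷_) (shuffle-allTrue {m} xs)

  shuffle-↭ : ∀ {m} (bs : Vec Bool m) xs → shuffle bs xs ↭ xs
  shuffle-↭ []           xs       = ↭-refl
  shuffle-↭ (b ∷ bs)     []       = ↭-refl
  shuffle-↭ (true ∷ bs)  (x ∷ xs) = prep x (shuffle-↭ bs xs)
  shuffle-↭ (false ∷ bs) (x ∷ xs) = ↭-trans (↭-sym (∷↭∷ʳ x (shuffle bs xs))) (prep x (shuffle-↭ bs xs))

  length-shuffle : ∀ {m} (bs : Vec Bool m) xs → length (shuffle bs xs) ≡ length xs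
  length-shuffle bs xs = ↭-length (shuffle-↭ bs xs)

  unshuffle-∷ʳ : ∀ {m} (bs : Vec Bool m) zs z → unshuffle (false ∷ bs) (zs ∷ʳ z) ≡ z ∷ unshuffle bs zs
  unshuffle-∷ʳ bs []       z = refl
  unshuffle-∷ʳ bs (a ∷ zs) z =
    cong (λ s → proj₂ s ∷ unshuffle bs (proj₁ s)) (splitLast-∷ʳ a zs z)

  unshuffle-shuffle : ∀ {m} (bs : Vec Bool m) xs → unshuffle bs (shuffle bs xs) ≡ xs
  unshuffle-shuffle []           xs       = refl
  unshuffle-shuffle (b ∷ bs)     []       = refl
  unshuffle-shuffle (true ∷ bs)  (x ∷ xs) = cong (x ∷_) (unshuffle-shuffle bs xs)
  unshuffle-shuffle (false ∷ bs) (x ∷ xs) =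
    trans (unshuffle-∷ʳ bs (shuffle bs xs) x) (cong (x ∷_) (unshuffle-shuffle bs xs))

  shuffle-unshuffle : ∀ {m} (bs : Vec Bool m) ys → shuffle bs (unshuffle bs ys) ≡ ys
  shuffle-unshuffle []           ys       = refl
  shuffle-unshuffle (b ∷ bs)     []       = refl
  shuffle-unshuffle (true ∷ bs)  (y ∷ ys) = cong (y ∷_) (shuffle-unshuffle bs ys)
  shuffle-unshuffle (false ∷ bs) (y ∷ ys) =
    trans (cong (_∷ʳ proj₂ (splitLast y ys)) (shuffle-unshuffle bs (proj₁ (splitLast y ys))))
          (splitLast-sound y ys)

  unshuffle-↭ : ∀ {m} (bs : Vec Bool m) ys → unshuffle bs ys ↭ ys
  unshuffle-↭ bs ys =
    ↭-trans (↭-sym (shuffle-↭ bs (unshuffle bs ys))) (↭-reflexive (shuffle-unshuffle bs ys))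

  length-unshuffle : ∀ {m} (bs : Vec Bool m) ys → length (unshuffle bs ys) ≡ length ys
  length-unshuffle bs ys = ↭-length (unshuffle-↭ bs ys)

  mtdrl-∷ʳ : ∀ {m} (bs : Vec Bool m) b (xs : List A) → length xs ≡ suc m →
    mtdrl (bs Vec.∷ʳ b) xs ≡ shuffle bs xs
  mtdrl-∷ʳ []           true  (x ∷ []) _ = refl
  mtdrl-∷ʳ []           false (x ∷ []) _ = refl
  mtdrl-∷ʳ (true ∷ bs)  b     (x ∷ xs) e = cong (x ∷_) (mtdrl-∷ʳ bs b xs (suc-injective e))
  mtdrl-∷ʳ (false ∷ bs) b     (x ∷ xs) e = begin
      ones Z ++ reverse (x ∷ zeros Z)    ≡⟨ cong (ones Z ++_) (unfold-reverse x (zeros Z)) ⟩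
      ones Z ++ (reverse (zeros Z) ∷ʳ x) ≡⟨ sym (++-assoc (ones Z) (reverse (zeros Z)) [ x ]) ⟩
      mtdrl (bs Vec.∷ʳ b) xs ∷ʳ x        ≡⟨ cong (_∷ʳ x) (mtdrl-∷ʳ bs b xs (suc-injective e)) ⟩
      shuffle bs xs ∷ʳ x                 ∎
    where
    open ≡-Reasoning
    Z = zip xs (Vec.toList (bs Vec.∷ʳ b))
  mtdrl-∷ʳ []           b     []            ()
  mtdrl-∷ʳ []           b     (x ∷ _ ∷ _)   ()
  mtdrl-∷ʳ (_ ∷ _)      b     []            ()

  -- A non-identity shuffle of a duplicate-free list of length 1 + m changes its
  -- last entry: the first entry with a false bit ends up last.
  shuffle-changes-last : ∀ {m} (bs : Vec Bool m) U u → Unique (U ∷ʳ u) → length U ≡ m →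
    bs ≢ allTrue → ∃₂ λ V v → shuffle bs (U ∷ʳ u) ≡ V ∷ʳ v × v ≢ u
  shuffle-changes-last [] U u _ _ nonId = ⊥-elim (nonId refl)
  shuffle-changes-last (true ∷ bs) (a ∷ U) u (_ ∷ uq) e nonId
    with shuffle-changes-last bs U u uq (suc-injective e) (nonId ∘ cong (true ∷_))
  ... | V , v , eq , v≢u = a ∷ V , v , cong (a ∷_) eq , v≢u
  shuffle-changes-last (false ∷ bs) (a ∷ U) u (a∉ ∷ _) _ _ =
    shuffle bs (U ∷ʳ u) , a , refl , All.lookup a∉ (∈-++⁺ʳ U (here refl))
  shuffle-changes-last (_ ∷ _) [] u _ () _

  first≢last : ∀ {x} (xs ys : List A) → All (x ≢_) ys → ys ≢ [] → x ∷ xs ≢ ys ∷ʳ x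
  first≢last xs []       _          ys≢[] _  = ys≢[] refl
  first≢last xs (y ∷ ys) (x≢y ∷ _) _     eq = x≢y (∷-injectiveˡ eq)

  keep≢move : ∀ {m} (bs bs′ : Vec Bool m) x W → Unique (x ∷ W) → length W ≡ suc m →
    x ∷ shuffle bs W ≢ shuffle bs′ W ∷ʳ x
  keep≢move bs bs′ x W (x∉ ∷ _) e =
    first≢last _ (shuffle bs′ W) (All-resp-↭ (↭-sym (shuffle-↭ bs′ W)) x∉) nonEmpty
    where
    nonEmpty : shuffle bs′ W ≢ []
    nonEmpty empty = 0≢1+n (trans (cong length (sym empty)) (trans (length-shuffle bs′ W) e))

  shuffle-injective : ∀ {m} (bs bs′ : Vec Bool m) W → Unique W → length W ≡ suc m →
    shuffle bs W ≡ shuffle bs′ W → bs ≡ bs′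
  shuffle-injective [] [] W _ _ _ = refl
  shuffle-injective (true ∷ bs) (true ∷ bs′) (x ∷ W) (_ ∷ u) e eq =
    cong (true ∷_) (shuffle-injective bs bs′ W u (suc-injective e) (∷-injectiveʳ eq))
  shuffle-injective (false ∷ bs) (false ∷ bs′) (x ∷ W) (_ ∷ u) e eq =
    cong (false ∷_) (shuffle-injective bs bs′ W u (suc-injective e) (∷ʳ-injectiveˡ _ _ eq))
  shuffle-injective (true ∷ bs) (false ∷ bs′) (x ∷ W) u e eq =
    ⊥-elim (keep≢move bs bs′ x W u (suc-injective e) eq)
  shuffle-injective (false ∷ bs) (true ∷ bs′) (x ∷ W) u e eq =
    ⊥-elim (keep≢move bs′ bs x W u (suc-injective e) (sym eq))
  shuffle-injective (_ ∷ _) (_ ∷ _) [] _ () _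

  unique-↭ : ∀ {xs ys : List A} → xs ↭ ys → Unique xs → Unique ys
  unique-↭ p = Permₛ.Unique-resp-↭ (setoid A) (↭⇒↭ₛ p)

  unique-middle : ∀ (T W : List A) {C} → Unique (T ++ W ++ C) → Unique W
  unique-middle (t ∷ T) W (_ ∷ u) = unique-middle T W u
  unique-middle [] [] u = []
  unique-middle [] (w ∷ W) (w∉ ∷ u) = Allₚ.++⁻ˡ W w∉ ∷ unique-middle [] W u

  -- Cutting σ at position j with a window of width k: σ = T ++ W ++ C where
  -- |T| = j and |W| = k.  As a view, matching on it rewrites σ and j.
  data Cut (k : ℕ) : ℕ → List A → Set where
    cut : ∀ T W C → length W ≡ k → Cut k (length T) (T ++ W ++ C)

  cutAt : ∀ σ j k → j + k ≤ length σ → Cut k j σ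
  cutAt σ       zero    k le = subst (Cut k 0) (take++drop≡id k σ)
    (cut [] (take k σ) (drop k σ) (trans (length-take k σ) (m≤n⇒m⊓n≡m le)))
  cutAt (x ∷ σ) (suc j) k (s≤s le) with cutAt σ j k le
  ... | cut T W C e = cut (x ∷ T) W C e

  atWindow : (List A → List A) → ℕ → ℕ → List A → List A
  atWindow f k j σ = take j σ ++ f (take k (drop j σ)) ++ drop (j + k) σ

  atWindow-cut : ∀ f T W C {k} → length W ≡ k → atWindow f k (length T) (T ++ W ++ C) ≡ T ++ f W ++ C
  atWindow-cut f []      W C refl = cong₂ (λ X Y → f X ++ Y) (take-length-++ W) (drop-length-++ W)
  atWindow-cut f (t ∷ T) W C refl = cong (t ∷_) (atWindow-cut f T W C refl)

  atWindow-cong : ∀ {f g k} j σ → (∀ W → length W ≡ k → f W ≡ g W) → j + k ≤ length σ →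
    atWindow f k j σ ≡ atWindow g k j σ
  atWindow-cong {f} {g} {k} j σ f≗g le with cutAt σ j k le
  ... | cut T W C e = begin
      atWindow f k (length T) (T ++ W ++ C) ≡⟨ atWindow-cut f T W C e ⟩
      T ++ f W ++ C                         ≡⟨ cong (λ X → T ++ X ++ C) (f≗g W e) ⟩
      T ++ g W ++ C                         ≡⟨ sym (atWindow-cut g T W C e) ⟩
      atWindow g k (length T) (T ++ W ++ C) ∎
    where open ≡-Reasoning

  atWindow-fixed : ∀ {f k} j σ → (∀ W → length W ≡ k → f W ≡ W) → j + k ≤ length σ →
    atWindow f k j σ ≡ σ
  atWindow-fixed {f} {k} j σ fix le with cutAt σ j k le
  ... | cut T W C e = trans (atWindow-cut f T W C e) (cong (λ X → T ++ X ++ C) (fix W e))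

  atWindow-∘ : ∀ {f g k} j σ → (∀ W → length W ≡ k → length (f W) ≡ k) → j + k ≤ length σ →
    atWindow g k j (atWindow f k j σ) ≡ atWindow (g ∘ f) k j σ
  atWindow-∘ {f} {g} {k} j σ keep le with cutAt σ j k le
  ... | cut T W C e = begin
      atWindow g k (length T) (atWindow f k (length T) (T ++ W ++ C))
        ≡⟨ cong (atWindow g k (length T)) (atWindow-cut f T W C e) ⟩
      atWindow g k (length T) (T ++ f W ++ C) ≡⟨ atWindow-cut g T (f W) C (keep W e) ⟩
      T ++ g (f W) ++ C                       ≡⟨ sym (atWindow-cut (g ∘ f) T W C e) ⟩
      atWindow (g ∘ f) k (length T) (T ++ W ++ C) ∎
    where open ≡-Reasoning

  atWindow-↭ : ∀ {f k} j σ → (∀ W → f W ↭ W) → j + k ≤ length σ → atWindow f k j σ ↭ σ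
  atWindow-↭ {f} {k} j σ perm le with cutAt σ j k le
  ... | cut T W C e = ↭-trans (↭-reflexive (atWindow-cut f T W C e)) (zoom T (perm W))

  drop-past : ∀ (T X C : List A) {k} → length X ≡ k → drop (length T + k) (T ++ X ++ C) ≡ C
  drop-past []      X C refl = drop-length-++ X
  drop-past (t ∷ T) X C e    = drop-past T X C e

  drop-atWindow : ∀ {f k} j σ → (∀ W → length W ≡ k → length (f W) ≡ k) → j + k ≤ length σ →
    drop (j + k) (atWindow f k j σ) ≡ drop (j + k) σ
  drop-atWindow {f} {k} j σ keep le with cutAt σ j k le
  ... | cut T W C e =
    trans (cong (drop (length T + k)) (atWindow-cut f T W C e))
          (trans (drop-past T (f W) C (keep W e)) (sym (drop-past T W C e)))

  last-separates : ∀ (xs ys : List A) {x y} C → length xs ≡ length ys → x ≢ y →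
    ∀ p → drop p (xs ++ x ∷ C) ≡ drop p (ys ++ y ∷ C) → length xs < p
  last-separates []       []       C _ x≢y zero    eq = ⊥-elim (x≢y (∷-injectiveˡ eq))
  last-separates []       []       C _ _   (suc p) _  = s≤s z≤n
  last-separates (a ∷ xs) (b ∷ ys) C e x≢y zero    eq =
    contradiction (last-separates xs ys C (suc-injective e) x≢y zero (∷-injectiveʳ eq)) λ ()
  last-separates (a ∷ xs) (b ∷ ys) C e x≢y (suc p) eq =
    s≤s (last-separates xs ys C (suc-injective e) x≢y p eq)
  last-separates []       (_ ∷ _)  C () _ _ _
  last-separates (_ ∷ _)  []       C () _ _ _

  shuffle-window-separates : ∀ {m} (bs : Vec Bool m) T U w C → Unique (U ∷ʳ w) → length U ≡ m →
    bs ≢ allTrue → ∀ p → drop p (T ++ shuffle bs (U ∷ʳ w) ++ C) ≡ drop p (T ++ (U ∷ʳ w) ++ C) →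
    length T + suc m ≤ p
  shuffle-window-separates {m} bs T U w C u lenU nonId p eq
    with shuffle-changes-last bs U w u lenU nonId
  ... | V , v , sh , v≢w = subst (_≤ p) (sym (+-suc (length T) m))
        (subst (λ l → suc l ≤ p) (trans (length-++ T) (cong (length T +_) lenV))
          (last-separates (T ++ V) (T ++ U) C lenTV v≢w p eq′))
    where
    lenV : length V ≡ m
    lenV = suc-injective (begin
      suc (length V)                ≡⟨ sym (length-∷ʳ V) ⟩
      length (V ∷ʳ v)               ≡⟨ cong length (sym sh) ⟩
      length (shuffle bs (U ∷ʳ w)) ≡⟨ length-shuffle bs (U ∷ʳ w) ⟩
      length (U ∷ʳ w)               ≡⟨ length-∷ʳ U ⟩
      suc (length U)                ≡⟨ cong suc lenU ⟩
      suc m                         ∎)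
      where open ≡-Reasoning
    lenTV : length (T ++ V) ≡ length (T ++ U)
    lenTV = trans (length-++ T) (trans (cong (length T +_) (trans lenV (sym lenU))) (sym (length-++ T)))
    rearrange : ∀ X x → T ++ (X ∷ʳ x) ++ C ≡ (T ++ X) ++ x ∷ C
    rearrange X x = trans (cong (T ++_) (++-assoc X [ x ] C)) (sym (++-assoc T X (x ∷ C)))
    eq′ : drop p ((T ++ V) ++ v ∷ C) ≡ drop p ((T ++ U) ++ w ∷ C)
    eq′ = trans (cong (drop p) (sym (trans (cong (λ X → T ++ X ++ C) sh) (rearrange V v))))
            (trans eq (cong (drop p) (rearrange U w)))

  move : ∀ {m} → ℕ × Vec Bool m → List A → List A
  move {m} (j , bs) = atWindow (shuffle bs) (suc m) j

  unmove : ∀ {m} → ℕ × Vec Bool m → List A → List A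
  unmove {m} (j , bs) = atWindow (unshuffle bs) (suc m) j

  move-allTrue : ∀ {m} j σ → j + suc m ≤ length σ → move (j , allTrue {m}) σ ≡ σ
  move-allTrue {m} j σ = atWindow-fixed {k = suc m} j σ (λ W _ → shuffle-allTrue {m} W)

  unmove-move : ∀ {m} j (bs : Vec Bool m) σ → j + suc m ≤ length σ →
    unmove (j , bs) (move (j , bs) σ) ≡ σ
  unmove-move {m} j bs σ le =
    trans (atWindow-∘ {shuffle bs} {unshuffle bs} {suc m} j σ (λ W e → trans (length-shuffle bs W) e) le)
          (atWindow-fixed {k = suc m} j σ (λ W _ → unshuffle-shuffle bs W) le)

  move-unmove : ∀ {m} j (bs : Vec Bool m) σ → j + suc m ≤ length σ →
    move (j , bs) (unmove (j , bs) σ) ≡ σ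
  move-unmove {m} j bs σ le =
    trans (atWindow-∘ {unshuffle bs} {shuffle bs} {suc m} j σ (λ W e → trans (length-unshuffle bs W) e) le)
          (atWindow-fixed {k = suc m} j σ (λ W _ → shuffle-unshuffle bs W) le)

  unmove-↭ : ∀ {m} j (bs : Vec Bool m) σ → j + suc m ≤ length σ → unmove (j , bs) σ ↭ σ
  unmove-↭ {m} j bs σ = atWindow-↭ {k = suc m} j σ (unshuffle-↭ bs)

  move-tail : ∀ {m} j (bs : Vec Bool m) σ → j + suc m ≤ length σ →
    drop (j + suc m) (move (j , bs) σ) ≡ drop (j + suc m) σ
  move-tail {m} j bs σ = drop-atWindow {shuffle bs} {suc m} j σ (λ W e → trans (length-shuffle bs W) e)

  -- The result of a non-identity move agrees with σ from position p on only when p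
  -- lies beyond the window: j + 1 + m is recoverable from the result.
  move-agrees-only-after : ∀ {m} j (bs : Vec Bool m) σ → Unique σ → j + suc m ≤ length σ →
    bs ≢ allTrue → ∀ p → drop p (move (j , bs) σ) ≡ drop p σ → j + suc m ≤ p
  move-agrees-only-after {m} j bs σ u le nonId p eq with cutAt σ j (suc m) le
  ... | cut T W C e with initLast W
  ...   | [] = ⊥-elim (0≢1+n e)
  ...   | U ∷ʳ′ w = shuffle-window-separates bs T U w C (unique-middle T (U ∷ʳ w) u)
          (suc-injective (trans (sym (length-∷ʳ U)) e)) nonId p
          (trans (cong (drop p) (sym (atWindow-cut (shuffle bs) T (U ∷ʳ w) C e))) eq)

  move-≢ : ∀ {m} j (bs : Vec Bool m) σ → Unique σ → j + suc m ≤ length σ → bs ≢ allTrue →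
    move (j , bs) σ ≢ σ
  move-≢ {m} j bs σ u le nonId eq =
    contradiction (m+n≤o⇒n≤o j (move-agrees-only-after j bs σ u le nonId 0 eq)) λ ()

  move-position : ∀ {m} j j′ (bs bs′ : Vec Bool m) σ → Unique σ →
    j + suc m ≤ length σ → j′ + suc m ≤ length σ → bs ≢ allTrue → bs′ ≢ allTrue →
    move (j , bs) σ ≡ move (j′ , bs′) σ → j ≡ j′
  move-position {m} j j′ bs bs′ σ u le le′ nonId nonId′ eq = ≤-antisym
    (+-cancelʳ-≤ (suc m) j j′ (move-agrees-only-after j bs σ u le nonId (j′ + suc m)
      (trans (cong (drop (j′ + suc m)) eq) (move-tail j′ bs′ σ le′))))
    (+-cancelʳ-≤ (suc m) j′ j (move-agrees-only-after j′ bs′ σ u le′ nonId′ (j + suc m)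
      (trans (cong (drop (j + suc m)) (sym eq)) (move-tail j bs σ le))))

  move-code : ∀ {m} j (bs bs′ : Vec Bool m) σ → Unique σ → j + suc m ≤ length σ →
    move (j , bs) σ ≡ move (j , bs′) σ → bs ≡ bs′
  move-code {m} j bs bs′ σ u le eq with cutAt σ j (suc m) le
  ... | cut T W C e = shuffle-injective bs bs′ W (unique-middle T W u) e
    (++-cancelʳ C _ _ (++-cancelˡ T _ _
      (trans (sym (atWindow-cut (shuffle bs) T W C e)) (trans eq (atWindow-cut (shuffle bs′) T W C e)))))

  move-injective : ∀ {m} j j′ (bs bs′ : Vec Bool m) σ → Unique σ →
    j + suc m ≤ length σ → j′ + suc m ≤ length σ → bs ≢ allTrue → bs′ ≢ allTrue →
    move (j , bs) σ ≡ move (j′ , bs′) σ → (j , bs) ≡ (j′ , bs′)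
  move-injective j j′ bs bs′ σ u le le′ nonId nonId′ eq
    with move-position j j′ bs bs′ σ u le le′ nonId nonId′ eq
  ... | refl = cong (j ,_) (move-code j bs bs′ σ u le eq)

  -- Two inverse moves with the same result coincide: moving the common result
  -- forward by either of them gives back σ.
  unmove-injective : ∀ {m} j j′ (bs bs′ : Vec Bool m) σ → Unique σ →
    j + suc m ≤ length σ → j′ + suc m ≤ length σ → bs ≢ allTrue → bs′ ≢ allTrue →
    unmove (j , bs) σ ≡ unmove (j′ , bs′) σ → (j , bs) ≡ (j′ , bs′)
  unmove-injective {m} j j′ bs bs′ σ u le le′ nonId nonId′ eq =
    move-injective j j′ bs bs′ ρ (unique-↭ (↭-sym ρ↭σ) u) (fits le) (fits le′) nonId nonId′
      (trans (move-unmove j bs σ le)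
        (sym (trans (cong (move (j′ , bs′)) eq) (move-unmove j′ bs′ σ le′))))
    where
    ρ = unmove (j , bs) σ
    ρ↭σ : ρ ↭ σ
    ρ↭σ = unmove-↭ j bs σ le
    fits : ∀ {i} → i + suc m ≤ length σ → i + suc m ≤ length ρ
    fits = subst (_ ≤_) (sym (↭-length ρ↭σ))

  unmove-≢ : ∀ {m} j (bs : Vec Bool m) σ → Unique σ → j + suc m ≤ length σ → bs ≢ allTrue →
    unmove (j , bs) σ ≢ σ
  unmove-≢ j bs σ u le nonId eq =
    move-≢ j bs σ u le nonId (trans (cong (move (j , bs)) (sym eq)) (move-unmove j bs σ le))

unique-map-on : ∀ {I B : Set} (g : I → B) (xs : List I) →
  (∀ {x y} → x ∈ xs → y ∈ xs → g x ≡ g y → x ≡ y) → Unique xs → Unique (map g xs)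
unique-map-on g []       _   []        = []
unique-map-on g (x ∷ xs) inj (x∉ ∷ u) =
  All.tabulate (λ y∈ gx≡ → let (y , y∈xs , ≡gy) = ∈-map⁻ g y∈
                           in All.lookup x∉ y∈xs (inj (here refl) (there y∈xs) (trans gx≡ ≡gy)))
  ∷ unique-map-on g xs (λ p q → inj (there p) (there q)) u

length-cartesianProduct : ∀ {I J : Set} (xs : List I) (ys : List J) →
  length (cartesianProduct xs ys) ≡ length xs * length ys
length-cartesianProduct []       ys = refl
length-cartesianProduct (x ∷ xs) ys =
  trans (length-++ (map (x ,_) ys)) (cong₂ _+_ (length-map (x ,_) ys) (length-cartesianProduct xs ys))

hasCard-image : ∀ {I : Set} (P : List ℕ → Set) x (g : I → List ℕ) (is : List I) {N} → Unique is →
  (∀ {i i′} → i ∈ is → i′ ∈ is → g i ≡ g i′ → i ≡ i′) → (∀ {i} → i ∈ is → g i ≢ x) →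
  (∀ y → P y ⇔ (y ≡ x ⊎ ∃[ i ] i ∈ is × y ≡ g i)) → length is ≡ N → HasCard P (N + 1)
hasCard-image P x g is u inj miss char refl =
  x ∷ map g is , unique , (λ y → mk⇔ (listed y) (list y)) , size
  where
  unique : Unique (x ∷ map g is)
  unique = All.tabulate (λ y∈ x≡y → let (i , i∈ , y≡gi) = ∈-map⁻ g y∈ in miss i∈ (sym (trans x≡y y≡gi)))
         ∷ unique-map-on g is inj u
  listed : ∀ y → y ∈ x ∷ map g is → P y
  listed y (here refl) = Equivalence.from (char y) (inj₁ refl)
  listed y (there y∈)  =
    let (i , i∈ , y≡gi) = ∈-map⁻ g y∈ in Equivalence.from (char y) (inj₂ (i , i∈ , y≡gi))
  list : ∀ y → P y → y ∈ x ∷ map g is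
  list y py with Equivalence.to (char y) py
  ... | inj₁ refl             = here refl
  ... | inj₂ (i , i∈ , refl) = there (∈-map⁺ g i∈)
  size : length (x ∷ map g is) ≡ length is + 1
  size = trans (cong suc (length-map g is)) (+-comm 1 (length is))

branch : ∀ {m} → List (Vec Bool m) → List (Vec Bool m) → List (Vec Bool (suc m))
branch ts fs = map (true ∷_) ts ++ map (false ∷_) fs

length-branch : ∀ {m} (ts fs : List (Vec Bool m)) → length (branch ts fs) ≡ length ts + length fs
length-branch ts fs =
  trans (length-++ (map (true ∷_) ts)) (cong₂ _+_ (length-map (true ∷_) ts) (length-map (false ∷_) fs))

unique-branch : ∀ {m} {ts fs : List (Vec Bool m)} → Unique ts → Unique fs → Unique (branch ts fs)
unique-branch {ts = ts} {fs} ut uf =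
  Uniqueₚ.++⁺ (Uniqueₚ.map⁺ Vecₚ.∷-injectiveʳ ut) (Uniqueₚ.map⁺ Vecₚ.∷-injectiveʳ uf) disjoint
  where
  disjoint : ∀ {v} → ¬ (v ∈ map (true ∷_) ts × v ∈ map (false ∷_) fs)
  disjoint (p , q) with ∈-map⁻ (true ∷_) p | ∈-map⁻ (false ∷_) q
  ... | _ , _ , refl | _ , _ , ()

codes : (m : ℕ) → List (Vec Bool m)
codes zero    = [ [] ]
codes (suc m) = branch (codes m) (codes m)

nonIdentity : (m : ℕ) → List (Vec Bool m)
nonIdentity zero    = []
nonIdentity (suc m) = branch (nonIdentity m) (codes m)

∈-codes : ∀ {m} (bs : Vec Bool m) → bs ∈ codes m
∈-codes []           = here refl
∈-codes (true ∷ bs)  = ∈-++⁺ˡ (∈-map⁺ (true ∷_) (∈-codes bs))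
∈-codes (false ∷ bs) = ∈-++⁺ʳ _ (∈-map⁺ (false ∷_) (∈-codes bs))

∈-nonIdentity⁺ : ∀ {m} (bs : Vec Bool m) → bs ≢ allTrue → bs ∈ nonIdentity m
∈-nonIdentity⁺ []           nonId = ⊥-elim (nonId refl)
∈-nonIdentity⁺ (true ∷ bs)  nonId = ∈-++⁺ˡ (∈-map⁺ (true ∷_) (∈-nonIdentity⁺ bs (nonId ∘ cong (true ∷_))))
∈-nonIdentity⁺ (false ∷ bs) _     = ∈-++⁺ʳ _ (∈-map⁺ (false ∷_) (∈-codes bs))

allTrue∉nonIdentity : ∀ m → allTrue ∉ nonIdentity m
allTrue∉nonIdentity zero    ()
allTrue∉nonIdentity (suc m) p with ∈-++⁻ (map (true ∷_) (nonIdentity m)) p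
... | inj₁ q with ∈-map⁻ (true ∷_) q
...   | cs , cs∈ , eq = allTrue∉nonIdentity m (subst (_∈ nonIdentity m) (sym (Vecₚ.∷-injectiveʳ eq)) cs∈)
allTrue∉nonIdentity (suc m) p | inj₂ q with ∈-map⁻ (false ∷_) q
...   | _ , _ , ()

∈-nonIdentity⁻ : ∀ {m} {bs : Vec Bool m} → bs ∈ nonIdentity m → bs ≢ allTrue
∈-nonIdentity⁻ {m} bs∈ bs≡ = allTrue∉nonIdentity m (subst (_∈ nonIdentity m) bs≡ bs∈)

unique-codes : ∀ m → Unique (codes m)
unique-codes zero    = [] ∷ []
unique-codes (suc m) = unique-branch (unique-codes m) (unique-codes m)

unique-nonIdentity : ∀ m → Unique (nonIdentity m)
unique-nonIdentity zero    = []
unique-nonIdentity (suc m) = unique-branch (unique-nonIdentity m) (unique-codes m)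

length-codes : ∀ m → length (codes m) ≡ 2 ^ m
length-codes zero    = refl
length-codes (suc m) = begin
  length (branch (codes m) (codes m)) ≡⟨ length-branch (codes m) (codes m) ⟩
  length (codes m) + length (codes m) ≡⟨ cong₂ _+_ (length-codes m) (length-codes m) ⟩
  2 ^ m + 2 ^ m                       ≡⟨ cong (2 ^ m +_) (sym (+-identityʳ (2 ^ m))) ⟩
  2 ^ suc m                           ∎
  where open ≡-Reasoning

length-nonIdentity : ∀ m → length (nonIdentity m) ≡ 2 ^ m ∸ 1
length-nonIdentity zero    = refl
length-nonIdentity (suc m) = begin
  length (branch (nonIdentity m) (codes m))  ≡⟨ length-branch (nonIdentity m) (codes m) ⟩
  length (nonIdentity m) + length (codes m)  ≡⟨ cong₂ _+_ (length-nonIdentity m) (length-codes m) ⟩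
  (2 ^ m ∸ 1) + 2 ^ m                        ≡⟨ +-comm (2 ^ m ∸ 1) (2 ^ m) ⟩
  2 ^ m + (2 ^ m ∸ 1)                        ≡⟨ sym (+-∸-assoc (2 ^ m) (m^n>0 2 m)) ⟩
  2 ^ m + 2 ^ m ∸ 1                          ≡⟨ cong (λ x → 2 ^ m + x ∸ 1) (sym (+-identityʳ (2 ^ m))) ⟩
  2 ^ suc m ∸ 1                              ∎
  where open ≡-Reasoning

positions : ℕ → ℕ → List ℕ
positions n k = upTo (n ∸ k + 1)

∈-positions⁺ : ∀ {n k j} → j + k ≤ n → j ∈ positions n k
∈-positions⁺ {n} {k} {j} le = ∈-upTo⁺ (subst (suc j ≤_) (+-comm 1 (n ∸ k)) (s≤s (m+n≤o⇒m≤o∸n j le)))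

∈-positions⁻ : ∀ {n k j} → k ≤ n → j ∈ positions n k → j + k ≤ n
∈-positions⁻ {n} {k} {j} k≤n j∈ =
  m≤o∸n⇒m+n≤o j k≤n (m<1+n⇒m≤n (subst (suc j ≤_) (+-comm (n ∸ k) 1) (∈-upTo⁻ j∈)))

moves : ℕ → (m : ℕ) → List (ℕ × Vec Bool m)
moves n m = cartesianProduct (positions n (suc m)) (nonIdentity m)

∈-moves⁺ : ∀ {n m j} {bs : Vec Bool m} → j + suc m ≤ n → bs ≢ allTrue → (j , bs) ∈ moves n m
∈-moves⁺ {bs = bs} le nonId = ∈-cartesianProduct⁺ (∈-positions⁺ le) (∈-nonIdentity⁺ bs nonId)

∈-moves⁻ : ∀ {n m j} {bs : Vec Bool m} → suc m ≤ n → (j , bs) ∈ moves n m → j + suc m ≤ n × bs ≢ allTrue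
∈-moves⁻ {n} {m} k≤n i∈ =
  let (j∈ , bs∈) = ∈-cartesianProduct⁻ (positions n (suc m)) (nonIdentity m) i∈
  in ∈-positions⁻ k≤n j∈ , ∈-nonIdentity⁻ bs∈

unique-moves : ∀ n m → Unique (moves n m)
unique-moves n m = Uniqueₚ.cartesianProduct⁺ (Uniqueₚ.upTo⁺ (n ∸ suc m + 1)) (unique-nonIdentity m)

length-moves : ∀ n m → length (moves n m) ≡ (n ∸ suc m + 1) * (2 ^ m ∸ 1)
length-moves n m = trans (length-cartesianProduct (positions n (suc m)) (nonIdentity m))
  (cong₂ _*_ (length-upTo (n ∸ suc m + 1)) (length-nonIdentity m))

perm-unique : ∀ {n σ} → IsPerm n σ → Unique σ
perm-unique {n} p = unique-↭ (↭-sym p) (Uniqueₚ.map⁺ suc-injective (Uniqueₚ.upTo⁺ n))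

perm-length : ∀ {n σ} → IsPerm n σ → length σ ≡ n
perm-length {n} p = trans (↭-length p) (trans (length-map suc (upTo n)) (length-upTo n))

bmtdrl-move : ∀ {m} j (bs : Vec Bool m) b σ → j + suc m ≤ length σ →
  bmtdrl (suc m) j (bs Vec.∷ʳ b) σ ≡ move (j , bs) σ
bmtdrl-move {m} j bs b σ = atWindow-cong {f = mtdrl (bs Vec.∷ʳ b)} {shuffle bs} {suc m} j σ (mtdrl-∷ʳ bs b)

Sout-char : ∀ {n m} σ → length σ ≡ n → suc m ≤ n → ∀ ρ →
  Sout (suc m) σ ρ ⇔ (ρ ≡ σ ⊎ ∃[ i ] i ∈ moves n m × ρ ≡ move i σ)
Sout-char {n} {m} σ refl k≤n ρ = mk⇔ (to ρ) (from ρ)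
  where
  to : ∀ ρ → Sout (suc m) σ ρ → ρ ≡ σ ⊎ ∃[ i ] i ∈ moves n m × ρ ≡ move i σ
  to _ (j , le , v , refl) with Vec.initLast v
  ... | bs , b , refl with Vecₚ.≡-dec _≟_ bs allTrue
  ...   | yes refl  = inj₁ (trans (bmtdrl-move j allTrue b σ le) (move-allTrue j σ le))
  ...   | no  nonId = inj₂ ((j , bs) , ∈-moves⁺ le nonId , bmtdrl-move j bs b σ le)
  from : ∀ ρ → ρ ≡ σ ⊎ ∃[ i ] i ∈ moves n m × ρ ≡ move i σ → Sout (suc m) σ ρ
  from _ (inj₁ refl) =
    0 , k≤n , allTrue Vec.∷ʳ true , sym (trans (bmtdrl-move 0 allTrue true σ k≤n) (move-allTrue 0 σ k≤n))
  from _ (inj₂ ((j , bs) , i∈ , refl)) =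
    j , le , bs Vec.∷ʳ true , sym (bmtdrl-move j bs true σ le)
    where le = proj₁ (∈-moves⁻ k≤n i∈)

Sin-char : ∀ {n m} π → IsPerm n π → suc m ≤ n → ∀ ρ →
  Sin n (suc m) π ρ ⇔ (ρ ≡ π ⊎ ∃[ i ] i ∈ moves n m × ρ ≡ unmove i π)
Sin-char {n} {m} π hp k≤n ρ = mk⇔ (to ρ) (from ρ)
  where
  fits : ∀ {σ j} {bs : Vec Bool m} → IsPerm n σ → (j , bs) ∈ moves n m → j + suc m ≤ length σ
  fits hσ i∈ = subst (_ ≤_) (sym (perm-length hσ)) (proj₁ (∈-moves⁻ k≤n i∈))
  to : ∀ ρ → Sin n (suc m) π ρ → ρ ≡ π ⊎ ∃[ i ] i ∈ moves n m × ρ ≡ unmove i π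
  to ρ (hρ , s) with Equivalence.to (Sout-char ρ (perm-length hρ) k≤n π) s
  ... | inj₁ π≡ρ = inj₁ (sym π≡ρ)
  ... | inj₂ ((j , bs) , i∈ , π≡) =
    inj₂ ((j , bs) , i∈ , trans (sym (unmove-move j bs ρ (fits hρ i∈))) (cong (unmove (j , bs)) (sym π≡)))
  from : ∀ ρ → ρ ≡ π ⊎ ∃[ i ] i ∈ moves n m × ρ ≡ unmove i π → Sin n (suc m) π ρ
  from _ (inj₁ refl) = hp , Equivalence.from (Sout-char π (perm-length hp) k≤n π) (inj₁ refl)
  from _ (inj₂ ((j , bs) , i∈ , refl)) =
    hρ , Equivalence.from (Sout-char _ (perm-length hρ) k≤n π)
           (inj₂ ((j , bs) , i∈ , sym (move-unmove j bs π (fits hp i∈))))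
    where
    hρ : IsPerm n (unmove (j , bs) π)
    hρ = ↭-trans (unmove-↭ j bs π (fits hp i∈)) hp

module Cardinalities {n m : ℕ} (k≤n : suc m ≤ n) (π : List ℕ) (hp : IsPerm n π) where

  private
    fits : ∀ {i} → i ∈ moves n m → proj₁ i + suc m ≤ length π
    fits i∈ = subst (_ ≤_) (sym (perm-length hp)) (proj₁ (∈-moves⁻ k≤n i∈))

    nonId : ∀ {i} → i ∈ moves n m → proj₂ i ≢ allTrue
    nonId i∈ = proj₂ (∈-moves⁻ k≤n i∈)

  Sout-card : HasCard (Sout (suc m) π) ((n ∸ suc m + 1) * (2 ^ m ∸ 1) + 1)
  Sout-card = hasCard-image (Sout (suc m) π) π (λ i → move i π) (moves n m) (unique-moves n m)
    (λ {i} {i′} i∈ i′∈ → move-injective (proj₁ i) (proj₁ i′) (proj₂ i) (proj₂ i′) π (perm-unique hp)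
                            (fits i∈) (fits i′∈) (nonId i∈) (nonId i′∈))
    (λ {i} i∈ → move-≢ (proj₁ i) (proj₂ i) π (perm-unique hp) (fits i∈) (nonId i∈))
    (Sout-char π (perm-length hp) k≤n) (length-moves n m)

  Sin-card : HasCard (Sin n (suc m) π) ((n ∸ suc m + 1) * (2 ^ m ∸ 1) + 1)
  Sin-card = hasCard-image (Sin n (suc m) π) π (λ i → unmove i π) (moves n m) (unique-moves n m)
    (λ {i} {i′} i∈ i′∈ → unmove-injective (proj₁ i) (proj₁ i′) (proj₂ i) (proj₂ i′) π (perm-unique hp)
                            (fits i∈) (fits i′∈) (nonId i∈) (nonId i′∈))
    (λ {i} i∈ → unmove-≢ (proj₁ i) (proj₂ i) π (perm-unique hp) (fits i∈) (nonId i∈))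
    (Sin-char π hp k≤n) (length-moves n m)

theorem9 : (n k : ℕ) → 1 ≤ k → k ≤ n → (π : List ℕ) → IsPerm n π →
    HasCard (Sout k π) ((n ∸ k + 1) * (2 ^ (k ∸ 1) ∸ 1) + 1)
      × HasCard (Sin n k π) ((n ∸ k + 1) * (2 ^ (k ∸ 1) ∸ 1) + 1)
theorem9 n zero    () _ _ _
theorem9 n (suc m) _ k≤n π hp = Cardinalities.Sout-card k≤n π hp , Cardinalities.Sin-card k≤n π hp
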